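{- Let $1\le n\le 9$ and let $P$ be the path on vertices $v_1,\dots,v_n$ with edges $v_iv_{i+1}$. Every orientation of $P$ is $(2,3)$-cordial, except when $n=4$ and the orientation is one in which the first edge $v_1v_2$ and the last edge $v_3v_4$ are oriented in opposite senses along the path (i.e. exactly one of $\overrightarrow{v_1v_2}$, $\overrightarrow{v_3v_4}$ is an arc); these four orientations, $v_1\to v_2\to v_3\leftarrow v_4$, $v_1\to v_2\leftarrow v_3\leftarrow v_4$, $v_1\leftarrow v_2\leftarrow v_3\to v_4$, $v_1\leftarrow v_2\to v_3\to v_4$, are not $(2,3)$-cordial.
   Context: A $(0,1)$-labeling $f$ of a finite set $Z$ is friendly if $-1\le |f^{ -1}(0)|-|f^{ -1}(1)|\le 1$; more generally, a labeling $h:Z\to \mathcal{A}$ is friendly if $-1\le |h^{ -1}(i)|-|h^{ -1}(j)|\le 1$ for all $i,j\in\mathcal{A}$. For a digraph $D=(V,A)$ without loops, multiple arcs or digons, and a friendly labeling $f:V\to\{0,1\}$, the induced arc labeling is $g:A\to\{1,0,-1\}$, $g(\overrightarrow{uv})=f(v)-f(u)$ for the arc directed from $u$ to $v$. The labeling is $(2,3)$-cordial if $g$ is friendly (the numbers of arcs labeled $1$, $0$, $-1$ pairwise differ by at most $1$), and $D$ is a $(2,3)$-cordial digraph if it admits such a friendly vertex labeling $f$. An orientation of a graph assigns a direction to each edge. -}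

module Defs where

open import Data.Nat using (ℕ; zero; suc; _+_; _≤_)
open import Data.Bool using (Bool; true; false)
open import Data.Fin using (Fin; zero; suc; inject₁)
open import Data.List using (List; []; _∷_; map; filter; length; allFin)
open import Data.Product using (_×_; _,_; ∃)
open import Data.Integer using (ℤ; +_; -_; _-_)
open import Relation.Binary.PropositionalEquality using (_≡_)
open import Relation.Nullary using (does)
import Data.Integer as ℤ
import Data.Nat as ℕ

-- A digraph on vertex set Fin n, given by its list of arcs (u , v) meaning u → v.
-- (Loops, multiple arcs and digons are excluded by construction for oriented paths.)
record Digraph (n : ℕ) : Set where
  constructor digraph
  field arcs : List (Fin n × Fin n)
open Digraph public

count : {A : Set} → (A → Bool) → List A → ℕ
count p [] = 0
count p (x ∷ xs) with p x
... | true  = suc (count p xs)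
... | false = count p xs

close : ℕ → ℕ → Set
close a b = (a ≤ suc b) × (b ≤ suc a)

isTrue : Bool → Bool
isTrue b = b

isFalse : Bool → Bool
isFalse true = false
isFalse false = true

-- vertex 0/1-labeling: false = label 0, true = label 1
Labeling : ℕ → Set
Labeling n = Fin n → Bool

FriendlyV : {n : ℕ} → Labeling n → Set
FriendlyV {n} f = close (count (λ v → isFalse (f v)) (allFin n))
                        (count (λ v → isTrue (f v)) (allFin n))

bit : Bool → ℤ
bit false = + 0
bit true  = + 1

arcLabel : {n : ℕ} → Labeling n → Fin n × Fin n → ℤ
arcLabel f (u , v) = bit (f v) - bit (f u)

eqℤ : ℤ → ℤ → Bool
eqℤ a b = does (a ℤ.≟ b)

nArcs : {n : ℕ} → Digraph n → Labeling n → ℤ → ℕ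
nArcs D f k = count (λ a → eqℤ (arcLabel f a) k) (arcs D)

Cordial23Labeling : {n : ℕ} → Digraph n → Labeling n → Set
Cordial23Labeling D f =
  FriendlyV f ×
  close (nArcs D f (+ 1)) (nArcs D f (+ 0)) ×
  close (nArcs D f (+ 1)) (nArcs D f (- (+ 1))) ×
  close (nArcs D f (+ 0)) (nArcs D f (- (+ 1)))

Cordial23 : {n : ℕ} → Digraph n → Set
Cordial23 D = ∃ λ f → Cordial23Labeling D f

-- An orientation of the path v₀ v₁ … vₘ (m+1 vertices, edges vᵢvᵢ₊₁ indexed by Fin m):
-- o i = true means the arc vᵢ → vᵢ₊₁, false means vᵢ₊₁ → vᵢ.
PathOrientation : ℕ → Set
PathOrientation m = Fin m → Bool

orientedArc : {m : ℕ} → Bool → Fin m → Fin (suc m) × Fin (suc m)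
orientedArc true  i = (inject₁ i , suc i)
orientedArc false i = (suc i , inject₁ i)

orientedPath : (m : ℕ) → PathOrientation m → Digraph (suc m)
orientedPath m o = digraph (map (λ i → orientedArc (o i) i) (allFin m))

{-# OPTIONS --safe #-}
module Submission where

-- All questions involved are finite: a labeling or an orientation of a path with
-- at most nine vertices is one of at most 2⁹ Boolean functions, and (2,3)-cordiality
-- of a given labeling is a decidable condition on natural numbers. Deciding
-- "∀ orientation ∃ labeling" by exhaustive search therefore settles every case.

open import Defs
open import Data.Nat using (ℕ; suc; _≤_; _≤?_; s≤s)
open import Data.Fin using (Fin; zero; suc)
open import Data.Fin.Subset.Properties using (anySubset?)
open import Data.Bool using (Bool)
open import Data.Bool.Properties using (_≟_)
open import Data.Empty using (⊥-elim)
open import Data.List using (List; []; _∷_; allFin)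
open import Data.List.Properties using (map-cong)
open import Data.Integer using (ℤ; +_; -_)
import Data.Integer as ℤ
open import Data.Product using (_×_; _,_; ∃)
open import Data.Vec using (lookup; tabulate)
open import Data.Vec.Properties using (lookup∘tabulate)
open import Function using (_∘_)
open import Relation.Nullary using (¬_; Dec)
open import Relation.Nullary.Decidable
  using (map′; from-yes; decidable-stable; ¬?; _×-dec_; _→-dec_)
open import Relation.Binary.PropositionalEquality
  using (_≡_; _≗_; refl; sym; trans; cong; cong₂; subst)

count-cong : {A : Set} {p q : A → Bool} → p ≗ q → (xs : List A) → count p xs ≡ count q xs
count-cong p≗q [] = refl
count-cong {p = p} {q} p≗q (x ∷ xs) with p x | q x | p≗q x
... | Bool.true  | Bool.true  | refl = cong suc (count-cong p≗q xs)
... | Bool.false | Bool.false | refl = count-cong p≗q xs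

close-cong : ∀ {a b c d} → a ≡ c → b ≡ d → close a b → close c d
close-cong refl refl ab = ab

close? : (a b : ℕ) → Dec (close a b)
close? a b = (a ≤? suc b) ×-dec (b ≤? suc a)

module _ {n : ℕ} (D : Digraph n) where

  cordial23Labeling-cong : {f g : Labeling n} → f ≗ g →
                           Cordial23Labeling D f → Cordial23Labeling D g
  cordial23Labeling-cong {f} {g} f≗g (friendly , c₁₀ , c₁₋ , c₀₋) =
    close-cong (count-cong (cong isFalse ∘ f≗g) (allFin n))
               (count-cong (cong isTrue ∘ f≗g) (allFin n)) friendly ,
    close-cong (nArcs-cong (+ 1)) (nArcs-cong (+ 0)) c₁₀ ,
    close-cong (nArcs-cong (+ 1)) (nArcs-cong (- + 1)) c₁₋ ,
    close-cong (nArcs-cong (+ 0)) (nArcs-cong (- + 1)) c₀₋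
    where
    arcLabel-cong : arcLabel f ≗ arcLabel g
    arcLabel-cong (u , v) = cong₂ (λ a b → bit a ℤ.- bit b) (f≗g v) (f≗g u)

    nArcs-cong : (k : ℤ) → nArcs D f k ≡ nArcs D g k
    nArcs-cong k = count-cong (λ a → cong (λ z → eqℤ z k) (arcLabel-cong a)) (arcs D)

  cordial23Labeling? : (f : Labeling n) → Dec (Cordial23Labeling D f)
  cordial23Labeling? f = close? _ _ ×-dec close? _ _ ×-dec close? _ _ ×-dec close? _ _

-- Boolean functions on Fin n are searched through their tables, i.e. subsets of Fin n,
-- which is why the property must be invariant under pointwise equality.
∃-boolFunction? : {n : ℕ} {P : (Fin n → Bool) → Set} →
                  (∀ {f g} → f ≗ g → P f → P g) → (∀ f → Dec (P f)) → Dec (∃ P)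
∃-boolFunction? P-resp P? =
  map′ (λ (v , p) → lookup v , p)
       (λ (f , p) → tabulate f , P-resp (sym ∘ lookup∘tabulate f) p)
       (anySubset? (P? ∘ lookup))

∀-boolFunction? : {n : ℕ} {P : (Fin n → Bool) → Set} →
                  (∀ {f g} → f ≗ g → P f → P g) → (∀ f → Dec (P f)) → Dec (∀ f → P f)
∀-boolFunction? P-resp P? =
  map′ (λ ∄counterexample f → decidable-stable (P? f) (λ ¬p → ∄counterexample (f , ¬p)))
       (λ ∀P (f , ¬p) → ¬p (∀P f))
       (¬? (∃-boolFunction? (λ f≗g ¬pf → ¬pf ∘ P-resp (sym ∘ f≗g)) (¬? ∘ P?)))

cordial23? : {n : ℕ} (D : Digraph n) → Dec (Cordial23 D)
cordial23? D = ∃-boolFunction? (cordial23Labeling-cong D) (cordial23Labeling? D)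

orientedPath-cong : (m : ℕ) {o o′ : PathOrientation m} → o ≗ o′ → orientedPath m o ≡ orientedPath m o′
orientedPath-cong m o≗o′ = cong digraph (map-cong (λ i → cong (λ b → orientedArc b i) (o≗o′ i)) (allFin m))

everyOrientationCordial23? : (m : ℕ) → Dec ((o : PathOrientation m) → Cordial23 (orientedPath m o))
everyOrientationCordial23? m =
  ∀-boolFunction? (λ o≗o′ → subst Cordial23 (orientedPath-cong m o≗o′)) (cordial23? ∘ orientedPath m)

EndsAgree : PathOrientation 3 → Set
EndsAgree o = o zero ≡ o (suc (suc zero))

Cordial23IffEndsAgree : PathOrientation 3 → Set
Cordial23IffEndsAgree o =
  (EndsAgree o → Cordial23 (orientedPath 3 o)) × (¬ EndsAgree o → ¬ Cordial23 (orientedPath 3 o))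

cordial23IffEndsAgree? : Dec ((o : PathOrientation 3) → Cordial23IffEndsAgree o)
cordial23IffEndsAgree? = ∀-boolFunction? resp decide
  where
  resp : ∀ {o o′} → o ≗ o′ → Cordial23IffEndsAgree o → Cordial23IffEndsAgree o′
  resp {o} {o′} o≗o′ (agree⇒cordial , disagree⇒¬cordial) =
      (λ agree → transport (agree⇒cordial (ends (sym ∘ o≗o′) agree)))
    , (λ disagree → disagree⇒¬cordial (disagree ∘ ends o≗o′) ∘ transport⁻)
    where
    ends : ∀ {p q : PathOrientation 3} → p ≗ q → EndsAgree p → EndsAgree q
    ends p≗q agree = trans (sym (p≗q zero)) (trans agree (p≗q (suc (suc zero))))
    transport  = subst Cordial23 (orientedPath-cong 3 o≗o′)
    transport⁻ = subst Cordial23 (sym (orientedPath-cong 3 o≗o′))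

  decide : ∀ o → Dec (Cordial23IffEndsAgree o)
  decide o = ((o zero ≟ _) →-dec cordial23? _) ×-dec (¬? (o zero ≟ _) →-dec ¬? (cordial23? _))

mainTheorem4 :
    ((m : ℕ) → suc m ≤ 9 → ¬ (m ≡ 3) → (o : PathOrientation m) → Cordial23 (orientedPath m o))
    × ((o : PathOrientation 3) →
        (o zero ≡ o (suc (suc zero)) → Cordial23 (orientedPath 3 o))
        × (¬ (o zero ≡ o (suc (suc zero))) → ¬ Cordial23 (orientedPath 3 o)))
mainTheorem4 = everyPathCordial23 , from-yes cordial23IffEndsAgree?
  where
  everyPathCordial23 : (m : ℕ) → suc m ≤ 9 → ¬ (m ≡ 3) → (o : PathOrientation m) → Cordial23 (orientedPath m o)
  everyPathCordial23 0 _ _ = from-yes (everyOrientationCordial23? 0)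
  everyPathCordial23 1 _ _ = from-yes (everyOrientationCordial23? 1)
  everyPathCordial23 2 _ _ = from-yes (everyOrientationCordial23? 2)
  everyPathCordial23 3 _ m≢3 = ⊥-elim (m≢3 refl)
  everyPathCordial23 4 _ _ = from-yes (everyOrientationCordial23? 4)
  everyPathCordial23 5 _ _ = from-yes (everyOrientationCordial23? 5)
  everyPathCordial23 6 _ _ = from-yes (everyOrientationCordial23? 6)
  everyPathCordial23 7 _ _ = from-yes (everyOrientationCordial23? 7)
  everyPathCordial23 8 _ _ = from-yes (everyOrientationCordial23? 8)
  everyPathCordial23 (suc (suc (suc (suc (suc (suc (suc (suc (suc _))))))))) (s≤s (s≤s (s≤s (s≤s (s≤s (s≤s (s≤s (s≤s (s≤s ()))))))))) _
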